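{- Let $k>1$ be an integer, let $a_1,\ldots,a_k\in\mathbb{Z}$, $n_1,\ldots,n_k\in\mathbb{Z}^+$, and let $\lambda_1,\ldots,\lambda_k\in\mathbb{Z}$ be weights. Define $w:\mathbb{Z}\to\mathbb{Z}$ by $w(x)=\sum_{1\leqslant s\leqslant k,\ n_s\mid x-a_s}\lambda_s$. Let $m\in\mathbb{Z}$ and suppose $n_0\in\mathbb{Z}^+$ is the smallest positive period of $w$ modulo $m$, i.e., the least positive integer with $w(x+n_0)\equiv w(x)\ (\mathrm{mod}\ m)$ for all $x\in\mathbb{Z}$. Let $d\in\mathbb{Z}^+$ be such that $d\nmid n_0$ and $I(d)=\{1\leqslant s\leqslant k: d\mid n_s\}\neq\emptyset$. Then either $m$ divides $[n_1,\ldots,n_k]\sum_{s\in I(d)}\lambda_s/n_s$ (where $[n_1,\ldots,n_k]$ is the least common multiple), or $$|I(d)|\geqslant |\{a_s\ \mathrm{mod}\ d:\ s\in I(d)\}|\geqslant \min_{\substack{0\leqslant s\leqslant k\\ s\notin I(d)}}\frac{d}{(d,n_s)}\geqslant p(d),$$ where $\{a_s\ \mathrm{mod}\ d: s\in I(d)\}$ is the set of residues of the $a_s$ ($s\in I(d)$) modulo $d$, $(d,n_s)$ is the greatest common divisor, and $p(d)$ is the smallest prime divisor of $d$.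
   Context: Congruence modulo $0$ means equality, and "$0$ divides $y$" means $y=0$. The minimum in the displayed inequality ranges over indices $s\in\{0,1,\ldots,k\}$ not in $I(d)$, including $s=0$ (with modulus $n_0$). -}

module Defs where

open import Data.Nat as ℕ using (ℕ; zero; suc; NonZero; _≤_; _<_; ≢-nonZero; ≢-nonZero⁻¹)
open import Data.Nat.Divisibility as ℕD using (_∣?_)
open import Data.Nat.GCD using (gcd; gcd[m,n]≢0)
open import Data.Nat.LCM using (lcm)
open import Data.Nat.Primality using (Prime)
open import Data.Integer as ℤ using (ℤ; +_; _-_; _%ℕ_)
open import Data.Integer.Divisibility as ℤD using ()
open import Data.Fin using (Fin; zero; suc)
open import Data.List using (List; map; filter; length; allFin; deduplicate)
open import Data.Sum using (inj₁)
open import Relation.Nullary using (Dec; yes; no; ¬_)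

Σℤ : (k : ℕ) → (Fin k → ℤ) → ℤ
Σℤ zero    f = + 0
Σℤ (suc k) f = f zero ℤ.+ Σℤ k (λ s → f (suc s))

when : ∀ {P : Set} → Dec P → ℤ → ℤ
when (yes _) v = v
when (no _)  v = + 0

-- w(x) = Σ_{1≤s≤k, n_s ∣ x - a_s} λ_s.  (In ℤ,  + n ∣ y  is by definition
-- n ∣ ∣ y ∣  in ℕ; the condition is decided in that form.)
w : (k : ℕ) (a : Fin k → ℤ) (n : Fin k → ℕ) (λs : Fin k → ℤ) → ℤ → ℤ
w k a n λs x = Σℤ k (λ s → when (n s ∣? ℤ.∣ x - a s ∣) (λs s))

-- p is a period of f modulo m: f(x + p) ≡ f(x) (mod m) for all x
-- (congruence modulo 0 is equality, as 0 ∣ y ⇔ y ≡ 0 for ℤ divisibility).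
IsPeriodMod : ℤ → (ℤ → ℤ) → ℕ → Set
IsPeriodMod m f p = ∀ (x : ℤ) → m ℤD.∣ (f (x ℤ.+ + p) - f x)

IsLeastPositivePeriodMod : ℤ → (ℤ → ℤ) → ℕ → Set
IsLeastPositivePeriodMod m f n₀ =
  (0 < n₀) × IsPeriodMod m f n₀ × (∀ p → 0 < p → IsPeriodMod m f p → n₀ ≤ p)
  where open import Data.Product using (_×_)

lcmAll : (k : ℕ) → (Fin k → ℕ) → ℕ
lcmAll zero    n = 1
lcmAll (suc k) n = lcm (n zero) (lcmAll k (λ s → n (suc s)))

Iset : (k : ℕ) (n : Fin k → ℕ) (d : ℕ) → List (Fin k)
Iset k n d = filter (λ s → d ∣? n s) (allFin k)

-- [n_1,...,n_k] · Σ_{s ∈ I(d)} λ_s / n_s  =  Σ_{s ∈ I(d)} λ_s · ([n_1,...,n_k] / n_s)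
-- (each n_s divides the lcm, so this is the exact integer value).
lcmWeightedSum : (k : ℕ) (n : Fin k → ℕ) (npos : ∀ s → NonZero (n s))
                 (λs : Fin k → ℤ) (d : ℕ) → ℤ
lcmWeightedSum k n npos λs d =
  Σℤ k (λ s → when (d ∣? n s)
                   (λs s ℤ.* + (ℕ._/_ (lcmAll k n) (n s) {{npos s}})))

residueCount : (k : ℕ) (a : Fin k → ℤ) (n : Fin k → ℕ) (d : ℕ) .{{_ : NonZero d}} → ℕ
residueCount k a n d =
  length (deduplicate ℕ._≟_ (map (λ s → a s %ℕ d) (Iset k n d)))

dOverGcd : (d : ℕ) .{{_ : NonZero d}} → ℕ → ℕ
dOverGcd d x =
  ℕ._/_ d (gcd d x) {{≢-nonZero (gcd[m,n]≢0 d x (inj₁ (≢-nonZero⁻¹ d)))}}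

nExt : (k : ℕ) → ℕ → (Fin k → ℕ) → Fin (suc k) → ℕ
nExt k n₀ n zero    = n₀
nExt k n₀ n (suc s) = n s

IsSmallestPrimeDivisor : ℕ → ℕ → Set
IsSmallestPrimeDivisor p d =
  Prime p × p ℕD.∣ d × (∀ q → Prime q → q ℕD.∣ d → p ≤ q)
  where open import Data.Product using (_×_)

-- Let r be the number of residues a_s mod d with s ∈ I(d).  If some s ∉ I(d)
-- (s = 0 included) has d/(d,n_s) ≤ r, the second alternative holds; its last
-- inequality holds because d/(d,n_s) > 1 has a prime factor, which divides d.
-- Otherwise every such n_s has additive order > r modulo d, and one builds a
-- d-periodic H : ℤ → ℤ that is 1 at each a_s (s ∈ I(d)) and sums to 0 along every
-- progression c + u j (j < L, d ∣ L u) whose step u has order > r modulo d.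
-- With N = [n_1, …, n_k], T = Σ_{x<N} w(x) H(x) is then computed in two ways.
-- Summing over each class a_s + n_s ℤ gives (N/n_s) λ_s for s ∈ I(d) and 0 otherwise,
-- so T = N Σ_{s∈I(d)} λ_s/n_s.  As n_0 divides the period N of w, grouping x by its
-- residue mod n_0 gives blocks on which w is constant mod m and H sums to 0, so m ∣ T.
--
-- H is built from the difference operators Δ_v f (y) = f y − f (y − v): the kernel
-- κ = (∏_{p ∣ d prime} Δ_{d/p}) 1_{dℤ} is 1 at 0 and sums to 0 along progressions
-- whose step is not a multiple of d, and H x = 1 − ((∏_{ρ ∈ R} Δ_{ρ−x}) κ)(0),
-- where R is the set of residues a_s mod d, s ∈ I(d).

module Submission where

open import Defs
open import Data.Nat using (ℕ; suc; NonZero; _≤_)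
open import Data.Nat.Divisibility using (_∣_)
open import Data.Integer using (ℤ)
open import Data.Integer.Divisibility as ℤD using ()
open import Data.Fin using (Fin; zero; suc)
open import Data.List using (length)
open import Data.Product using (_×_; ∃-syntax)
open import Data.Sum using (_⊎_)
open import Relation.Nullary using (¬_)

open import Data.Nat as ℕ using (zero; _<_)
import Data.Nat.Properties as ℕP
open import Data.Nat.Divisibility as ℕ∣ using (_∣?_)
import Data.Nat.DivMod as ℕDM
open import Data.Nat.GCD using (gcd; gcd-GCD; gcd[m,n]∣m; gcd[m,n]∣n; gcd[m,n]≢0; module Bézout)
open import Data.Nat.LCM using (m∣lcm[m,n]; n∣lcm[m,n])
open import Data.Nat.Coprimality using (coprime-/gcd; coprime-divisor)
open import Data.Nat.Primality using (Prime; prime?; euclidsLemma; prime⇒nonZero)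
open import Data.Nat.Primality.Factorisation using (factorise)
open import Data.Nat.ListAction using (product)
import Data.Nat.Tactic.RingSolver as ℕRing
open import Data.Integer as ℤ using (+_; _+_; _-_; _*_; -_; 0ℤ; 1ℤ)
import Data.Integer.Properties as ℤP
import Data.Integer.DivMod as ℤDM
open import Data.Integer.Divisibility.Signed as ℤ∣ using (divides) renaming (_∣_ to _∣ℤ_)
open import Data.Integer.Tactic.RingSolver using (solve-∀)
open import Data.Fin.Properties using (any?)
open import Data.List using (List; []; _∷_; map; deduplicate)
import Data.List.Properties as ListP
open import Data.List.Membership.Propositional using (_∈_; _─_)
open import Data.List.Membership.Propositional.Properties using (∈-map⁺; ∈-deduplicate⁺; ∈-filter⁺; ∈-allFin)
open import Data.List.Relation.Unary.Any using (here; there)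
open import Data.List.Relation.Unary.All using (_∷_)
open import Data.Product using (_,_; proj₁; proj₂)
open import Data.Sum using (inj₁; inj₂)
open import Relation.Nullary using (Dec; yes; no; ¬?)
open import Relation.Nullary.Decidable using (_×-dec_)
open import Relation.Nullary.Negation using (contradiction)
open import Relation.Binary.PropositionalEquality

open ≡-Reasoning

-- Finite sums

∑ : ℕ → (ℕ → ℤ) → ℤ
∑ zero    f = 0ℤ
∑ (suc n) f = ∑ n f + f n

syntax ∑ n (λ i → e) = ∑[ i < n ] e

∑-cong : ∀ n {f g : ℕ → ℤ} → (∀ i → f i ≡ g i) → ∑ n f ≡ ∑ n g
∑-cong zero    f≗g = refl
∑-cong (suc n) f≗g = cong₂ _+_ (∑-cong n f≗g) (f≗g n)

∑-zero : ∀ n {f : ℕ → ℤ} → (∀ i → f i ≡ 0ℤ) → ∑ n f ≡ 0ℤ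
∑-zero zero    f≗0 = refl
∑-zero (suc n) f≗0 = cong₂ _+_ (∑-zero n f≗0) (f≗0 n)

∑-+ : ∀ n (f g : ℕ → ℤ) → ∑[ i < n ] (f i + g i) ≡ ∑ n f + ∑ n g
∑-+ zero    f g = refl
∑-+ (suc n) f g = trans (cong (_+ (f n + g n)) (∑-+ n f g)) (interchange (∑ n f) (∑ n g) (f n) (g n))
  where
  interchange : ∀ a b c e → (a + b) + (c + e) ≡ (a + c) + (b + e)
  interchange = solve-∀

∑-- : ∀ n (f g : ℕ → ℤ) → ∑[ i < n ] (f i - g i) ≡ ∑ n f - ∑ n g
∑-- zero    f g = refl
∑-- (suc n) f g = trans (cong (_+ (f n - g n)) (∑-- n f g)) (interchange (∑ n f) (∑ n g) (f n) (g n))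
  where
  interchange : ∀ a b c e → (a - b) + (c - e) ≡ (a + c) - (b + e)
  interchange = solve-∀

∑-*ˡ : ∀ n c (f : ℕ → ℤ) → ∑[ i < n ] (c * f i) ≡ c * ∑ n f
∑-*ˡ zero    c f = sym (ℤP.*-zeroʳ c)
∑-*ˡ (suc n) c f = trans (cong (_+ c * f n) (∑-*ˡ n c f)) (sym (ℤP.*-distribˡ-+ c (∑ n f) (f n)))

∑-const : ∀ n c → ∑[ i < n ] c ≡ + n * c
∑-const zero    c = refl
∑-const (suc n) c = begin
  ∑[ i < n ] c + c  ≡⟨ cong (_+ c) (∑-const n c) ⟩
  + n * c + c       ≡⟨ distrib (+ n) c ⟩
  (1ℤ + + n) * c    ≡⟨ cong (_* c) (sym (ℤP.pos-+ 1 n)) ⟩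
  + suc n * c       ∎
  where
  distrib : ∀ a c → a * c + c ≡ (1ℤ + a) * c
  distrib = solve-∀

∑-head : ∀ n (f : ℕ → ℤ) → ∑ (suc n) f ≡ f 0 + ∑[ i < n ] f (suc i)
∑-head zero    f = trans (ℤP.+-identityˡ (f 0)) (sym (ℤP.+-identityʳ (f 0)))
∑-head (suc n) f = trans (cong (_+ f (suc n)) (∑-head n f)) (ℤP.+-assoc (f 0) _ (f (suc n)))

∑-split : ∀ m n (f : ℕ → ℤ) → ∑ (m ℕ.+ n) f ≡ ∑ m f + ∑[ i < n ] f (m ℕ.+ i)
∑-split m zero    f = trans (cong (λ t → ∑ t f) (ℕP.+-identityʳ m)) (sym (ℤP.+-identityʳ _))
∑-split m (suc n) f = begin
  ∑ (m ℕ.+ suc n) f                              ≡⟨ cong (λ t → ∑ t f) (ℕP.+-suc m n) ⟩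
  ∑ (m ℕ.+ n) f + f (m ℕ.+ n)                    ≡⟨ cong (_+ f (m ℕ.+ n)) (∑-split m n f) ⟩
  ∑ m f + ∑[ i < n ] f (m ℕ.+ i) + f (m ℕ.+ n)   ≡⟨ ℤP.+-assoc (∑ m f) _ (f (m ℕ.+ n)) ⟩
  ∑ m f + ∑[ i < suc n ] f (m ℕ.+ i)             ∎

∑-swap : ∀ a b (g : ℕ → ℕ → ℤ) → ∑[ i < a ] ∑[ j < b ] g i j ≡ ∑[ j < b ] ∑[ i < a ] g i j
∑-swap zero    b g = sym (∑-zero b (λ _ → refl))
∑-swap (suc a) b g = begin
  ∑[ i < a ] ∑[ j < b ] g i j + ∑[ j < b ] g a j  ≡⟨ cong (_+ ∑ b (g a)) (∑-swap a b g) ⟩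
  ∑[ j < b ] ∑[ i < a ] g i j + ∑[ j < b ] g a j  ≡⟨ sym (∑-+ b (λ j → ∑[ i < a ] g i j) (g a)) ⟩
  ∑[ j < b ] ∑[ i < suc a ] g i j                 ∎

∑-blocks : ∀ b a (f : ℕ → ℤ) → ∑ (b ℕ.* a) f ≡ ∑[ j < b ] ∑[ y < a ] f (j ℕ.* a ℕ.+ y)
∑-blocks zero    a f = refl
∑-blocks (suc b) a f = begin
  ∑ (a ℕ.+ b ℕ.* a) f                                   ≡⟨ cong (λ t → ∑ t f) (ℕP.+-comm a (b ℕ.* a)) ⟩
  ∑ (b ℕ.* a ℕ.+ a) f                                   ≡⟨ ∑-split (b ℕ.* a) a f ⟩
  ∑ (b ℕ.* a) f + ∑[ y < a ] f (b ℕ.* a ℕ.+ y)          ≡⟨ cong (_+ ∑[ y < a ] f (b ℕ.* a ℕ.+ y)) (∑-blocks b a f) ⟩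
  ∑[ j < suc b ] ∑[ y < a ] f (j ℕ.* a ℕ.+ y)           ∎

∑-residues : ∀ M n (f : ℕ → ℤ) → ∑ (M ℕ.* n) f ≡ ∑[ y < n ] ∑[ j < M ] f (j ℕ.* n ℕ.+ y)
∑-residues M n f = trans (∑-blocks M n f) (∑-swap M n (λ j y → f (j ℕ.* n ℕ.+ y)))

∑-rotate : ∀ L (f : ℕ → ℤ) → f L ≡ f 0 → ∑[ j < L ] f (suc j) ≡ ∑ L f
∑-rotate L f fL≡f0 = begin
  ∑[ j < L ] f (suc j)                  ≡⟨ add-subˡ (∑[ j < L ] f (suc j)) (f 0) ⟩
  (f 0 + ∑[ j < L ] f (suc j)) - f 0    ≡⟨ cong (_- f 0) (sym (∑-head L f)) ⟩
  (∑ L f + f L) - f 0                   ≡⟨ cong (λ t → (∑ L f + t) - f 0) fL≡f0 ⟩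
  (∑ L f + f 0) - f 0                   ≡⟨ sym (add-subʳ (∑ L f) (f 0)) ⟩
  ∑ L f                                 ∎
  where
  add-subˡ : ∀ s x → s ≡ (x + s) - x
  add-subˡ = solve-∀
  add-subʳ : ∀ s x → s ≡ (s + x) - x
  add-subʳ = solve-∀

∑-periodic-shift : ∀ L (f : ℕ → ℤ) → (∀ j → f (j ℕ.+ L) ≡ f j) → ∀ i → ∑[ j < L ] f (j ℕ.+ i) ≡ ∑ L f
∑-periodic-shift L f periodic zero    = ∑-cong L (λ j → cong f (ℕP.+-identityʳ j))
∑-periodic-shift L f periodic (suc i) = begin
  ∑[ j < L ] f (j ℕ.+ suc i)    ≡⟨ ∑-cong L (λ j → cong f (ℕP.+-suc j i)) ⟩
  ∑[ j < L ] f (suc j ℕ.+ i)    ≡⟨ ∑-rotate L (λ j → f (j ℕ.+ i)) (trans (cong f (ℕP.+-comm L i)) (periodic i)) ⟩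
  ∑[ j < L ] f (j ℕ.+ i)        ≡⟨ ∑-periodic-shift L f periodic i ⟩
  ∑ L f                         ∎

∑-∣ : ∀ n {m} (f : ℕ → ℤ) → (∀ i → m ∣ℤ f i) → m ∣ℤ ∑ n f
∑-∣ zero    f m∣f = divides 0ℤ refl
∑-∣ (suc n) f m∣f = ℤ∣.∣m∣n⇒∣m+n (∑-∣ n f m∣f) (m∣f n)

∣∑*-zero-sum : ∀ M {m} (A h : ℕ → ℤ) c → (∀ j → m ∣ℤ A j - c) → ∑ M h ≡ 0ℤ → m ∣ℤ ∑[ j < M ] (A j * h j)
∣∑*-zero-sum M {m} A h c m∣A-c ∑h≡0 = subst (m ∣ℤ_) (sym recentre) (∑-∣ M _ (λ j → ℤ∣.∣m⇒∣m*n (h j) (m∣A-c j)))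
  where
  split : ∀ a c h → a * h ≡ (a - c) * h + c * h
  split = solve-∀
  recentre : ∑[ j < M ] (A j * h j) ≡ ∑[ j < M ] ((A j - c) * h j)
  recentre = begin
    ∑[ j < M ] (A j * h j)                                 ≡⟨ ∑-cong M (λ j → split (A j) c (h j)) ⟩
    ∑[ j < M ] ((A j - c) * h j + c * h j)                 ≡⟨ ∑-+ M _ _ ⟩
    ∑[ j < M ] ((A j - c) * h j) + ∑[ j < M ] (c * h j)    ≡⟨ cong (_+_ (∑[ j < M ] ((A j - c) * h j))) (∑-*ˡ M c h) ⟩
    ∑[ j < M ] ((A j - c) * h j) + c * ∑ M h               ≡⟨ cong (λ t → ∑[ j < M ] ((A j - c) * h j) + c * t) ∑h≡0 ⟩
    ∑[ j < M ] ((A j - c) * h j) + c * 0ℤ                  ≡⟨ cong (_+_ (∑[ j < M ] ((A j - c) * h j))) (ℤP.*-zeroʳ c) ⟩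
    ∑[ j < M ] ((A j - c) * h j) + 0ℤ                      ≡⟨ ℤP.+-identityʳ _ ⟩
    ∑[ j < M ] ((A j - c) * h j)                           ∎

-- Conditional terms and residue classes

module _ {P : Set} where

  when-yes : (p : Dec P) (v : ℤ) → P → when p v ≡ v
  when-yes (yes _) v _  = refl
  when-yes (no ¬p) v p  = contradiction p ¬p

  when-no : (p : Dec P) (v : ℤ) → ¬ P → when p v ≡ 0ℤ
  when-no (yes p) v ¬p = contradiction p ¬p
  when-no (no _)  v _  = refl

  when-congʳ : (p : Dec P) {v v′ : ℤ} → (P → v ≡ v′) → when p v ≡ when p v′
  when-congʳ (yes p) v≡v′ = v≡v′ p
  when-congʳ (no _)  v≡v′ = refl

  when-*ʳ : (p : Dec P) (v c : ℤ) → when p v * c ≡ when p (v * c)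
  when-*ʳ (yes _) v c = refl
  when-*ʳ (no _)  v c = ℤP.*-zeroˡ c

  when≡*when1 : (p : Dec P) (v : ℤ) → when p v ≡ v * when p 1ℤ
  when≡*when1 (yes _) v = sym (ℤP.*-identityʳ v)
  when≡*when1 (no _)  v = sym (ℤP.*-zeroʳ v)

  ∑-when : ∀ M (p : Dec P) (f : ℕ → ℤ) → ∑[ j < M ] when p (f j) ≡ when p (∑ M f)
  ∑-when M (yes _) f = refl
  ∑-when M (no _)  f = ∑-zero M (λ _ → refl)

when-cong : ∀ {P Q : Set} (p : Dec P) (q : Dec Q) (v : ℤ) → (P → Q) → (Q → P) → when p v ≡ when q v
when-cong (yes _) (yes _) v P→Q Q→P = refl
when-cong (no _)  (no _)  v P→Q Q→P = refl
when-cong (yes p) (no ¬q) v P→Q Q→P = contradiction (P→Q p) ¬q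
when-cong (no ¬p) (yes q) v P→Q Q→P = contradiction (Q→P q) ¬p

∣∣-respects-≡mod : ∀ {n} x y → + n ∣ℤ x - y → n ∣ ℤ.∣ x ∣ → n ∣ ℤ.∣ y ∣
∣∣-respects-≡mod {n} x y n∣x-y n∣x =
  ℤ∣.∣⇒∣ᵤ (subst (+ n ∣ℤ_) (y≡x-[x-y] x y) (ℤ∣.∣m∣n⇒∣m-n {m = x} (ℤ∣.∣ᵤ⇒∣ n∣x) n∣x-y))
  where
  y≡x-[x-y] : ∀ x y → x - (x - y) ≡ y
  y≡x-[x-y] = solve-∀

when∣-cong : ∀ {n} x y (v : ℤ) → + n ∣ℤ x - y → when (n ∣? ℤ.∣ x ∣) v ≡ when (n ∣? ℤ.∣ y ∣) v
when∣-cong {n} x y v n∣x-y =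
  when-cong (n ∣? _) (n ∣? _) v (∣∣-respects-≡mod x y n∣x-y)
                                (∣∣-respects-≡mod y x (subst (+ n ∣ℤ_) (negate x y) (ℤ∣.∣m⇒∣-m n∣x-y)))
  where
  negate : ∀ x y → - (x - y) ≡ y - x
  negate = solve-∀

when∣-cong-sub : ∀ {n} x y a (v : ℤ) → + n ∣ℤ x - y →
                 when (n ∣? ℤ.∣ x - a ∣) v ≡ when (n ∣? ℤ.∣ y - a ∣) v
when∣-cong-sub {n} x y a v n∣x-y = when∣-cong (x - a) (y - a) v (subst (+ n ∣ℤ_) (sub-cancel x y a) n∣x-y)
  where
  sub-cancel : ∀ x y a → x - y ≡ (x - a) - (y - a)
  sub-cancel = solve-∀

∑-multiples-below : ∀ {n} .{{_ : NonZero n}} k → k < n → ∑[ y < suc k ] when (n ∣? y) 1ℤ ≡ 1ℤ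
∑-multiples-below {n} zero    _   = trans (ℤP.+-identityˡ _) (when-yes (n ∣? 0) 1ℤ (n ℕ∣.∣0))
∑-multiples-below {n} (suc k) k<n = begin
  ∑[ y < suc k ] when (n ∣? y) 1ℤ + when (n ∣? suc k) 1ℤ
    ≡⟨ cong₂ _+_ (∑-multiples-below k (ℕP.<-trans (ℕP.n<1+n k) k<n)) (when-no (n ∣? suc k) 1ℤ (ℕ∣.>⇒∤ k<n)) ⟩
  1ℤ ∎

n∣a-a%n : ∀ a n .{{_ : NonZero n}} → + n ∣ℤ a - + (a ℤ.%ℕ n)
n∣a-a%n a n = divides (a ℤ./ℕ n) (begin
  a - + (a ℤ.%ℕ n)                                  ≡⟨ cong (_- + (a ℤ.%ℕ n)) (ℤDM.a≡a%ℕn+[a/ℕn]*n a n) ⟩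
  (+ (a ℤ.%ℕ n) + a ℤ./ℕ n * + n) - + (a ℤ.%ℕ n)   ≡⟨ add-sub (+ (a ℤ.%ℕ n)) (a ℤ./ℕ n * + n) ⟩
  a ℤ./ℕ n * + n                                    ∎)
  where
  add-sub : ∀ r b → (r + b) - r ≡ b
  add-sub = solve-∀

∑-residue-indicator : ∀ n .{{_ : NonZero n}} a → ∑[ y < n ] when (n ∣? ℤ.∣ + y - a ∣) 1ℤ ≡ 1ℤ
∑-residue-indicator n@(suc k) a = begin
  ∑ n [≡a]                          ≡⟨ sym (∑-periodic-shift n [≡a] [≡a]-periodic b) ⟩
  ∑[ y < n ] [≡a] (y ℕ.+ b)         ≡⟨ ∑-cong n (λ y → when∣-cong (+ (y ℕ.+ b) - a) (+ y) 1ℤ (shifted y)) ⟩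
  ∑[ y < n ] when (n ∣? y) 1ℤ       ≡⟨ ∑-multiples-below k ℕP.≤-refl ⟩
  1ℤ                                ∎
  where
  [≡a] : ℕ → ℤ
  [≡a] y = when (n ∣? ℤ.∣ + y - a ∣) 1ℤ
  b : ℕ
  b = a ℤ.%ℕ n
  [≡a]-periodic : ∀ y → [≡a] (y ℕ.+ n) ≡ [≡a] y
  [≡a]-periodic y = when∣-cong-sub (+ (y ℕ.+ n)) (+ y) a 1ℤ
    (divides 1ℤ (trans (cong (_- + y) (ℤP.pos-+ y n)) (add-sub (+ y) (+ n))))
    where
    add-sub : ∀ y n → y + n - y ≡ 1ℤ * n
    add-sub = solve-∀
  shifted : ∀ y → + n ∣ℤ (+ (y ℕ.+ b) - a) - + y
  shifted y = subst (+ n ∣ℤ_) (trans (negate a (+ y) (+ b)) (cong (λ t → (t - a) - + y) (sym (ℤP.pos-+ y b))))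
                    (ℤ∣.∣m⇒∣-m (n∣a-a%n a n))
    where
    negate : ∀ a y b → - (a - b) ≡ (y + b - a) - y
    negate = solve-∀

pos-[j*n+y] : ∀ n j y → + (j ℕ.* n ℕ.+ y) ≡ + y + + n * + j
pos-[j*n+y] n j y = begin
  + (j ℕ.* n ℕ.+ y)     ≡⟨ ℤP.pos-+ (j ℕ.* n) y ⟩
  + (j ℕ.* n) + + y     ≡⟨ cong (_+ + y) (ℤP.pos-* j n) ⟩
  + j * + n + + y       ≡⟨ reorder (+ j) (+ n) (+ y) ⟩
  + y + + n * + j       ∎
  where
  reorder : ∀ j n y → j * n + y ≡ y + n * j
  reorder = solve-∀

n∣[j*n+y]-y : ∀ n j y → + n ∣ℤ + (j ℕ.* n ℕ.+ y) - + y
n∣[j*n+y]-y n j y = divides (+ j) (trans (cong (_- + y) (pos-[j*n+y] n j y)) (cancel (+ y) (+ n) (+ j)))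
  where
  cancel : ∀ y n j → y + n * j - y ≡ j * n
  cancel = solve-∀

∑-residue-class : ∀ M n .{{_ : NonZero n}} a (g : ℕ → ℤ) K →
                  (∀ y → n ∣ ℤ.∣ + y - a ∣ → ∑[ j < M ] g (j ℕ.* n ℕ.+ y) ≡ K) →
                  ∑[ x < M ℕ.* n ] when (n ∣? ℤ.∣ + x - a ∣) (g x) ≡ K
∑-residue-class M n a g K ∑-λH-on-class = begin
  ∑[ x < M ℕ.* n ] when ([≡a]? x) (g x)
    ≡⟨ ∑-residues M n _ ⟩
  ∑[ y < n ] ∑[ j < M ] when ([≡a]? (j ℕ.* n ℕ.+ y)) (g (j ℕ.* n ℕ.+ y))
    ≡⟨ ∑-cong n (λ y → ∑-cong M (λ j → when∣-cong-sub (+ (j ℕ.* n ℕ.+ y)) (+ y) a _ (n∣[j*n+y]-y n j y))) ⟩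
  ∑[ y < n ] ∑[ j < M ] when ([≡a]? y) (g (j ℕ.* n ℕ.+ y))
    ≡⟨ ∑-cong n (λ y → trans (∑-when M ([≡a]? y) _) (when-congʳ ([≡a]? y) (∑-λH-on-class y))) ⟩
  ∑[ y < n ] when ([≡a]? y) K
    ≡⟨ ∑-cong n (λ y → when≡*when1 ([≡a]? y) K) ⟩
  ∑[ y < n ] (K * when ([≡a]? y) 1ℤ)
    ≡⟨ ∑-*ˡ n K _ ⟩
  K * ∑[ y < n ] when ([≡a]? y) 1ℤ
    ≡⟨ cong (K *_) (∑-residue-indicator n a) ⟩
  K * 1ℤ
    ≡⟨ ℤP.*-identityʳ K ⟩
  K ∎
  where
  [≡a]? : ∀ x → Dec (n ∣ ℤ.∣ + x - a ∣)
  [≡a]? x = n ∣? ℤ.∣ + x - a ∣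

-- Difference operators on periodic functions

Periodic : ℕ → (ℤ → ℤ) → Set
Periodic d f = ∀ x y → + d ∣ℤ x - y → f x ≡ f y

Δ : ℤ → (ℤ → ℤ) → ℤ → ℤ
Δ v f y = f y - f (y - v)

Δ* : List ℤ → (ℤ → ℤ) → ℤ → ℤ
Δ* []       f = f
Δ* (v ∷ vs) f = Δ v (Δ* vs f)

Δ-periodic : ∀ {d f} v → Periodic d f → Periodic d (Δ v f)
Δ-periodic {d} v f-periodic x y d∣x-y =
  cong₂ _-_ (f-periodic x y d∣x-y) (f-periodic (x - v) (y - v) (subst (+ d ∣ℤ_) (sub-cancel x y v) d∣x-y))
  where
  sub-cancel : ∀ x y v → x - y ≡ (x - v) - (y - v)
  sub-cancel = solve-∀

Δ*-periodic : ∀ {d f} vs → Periodic d f → Periodic d (Δ* vs f)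
Δ*-periodic []       f-periodic = f-periodic
Δ*-periodic (v ∷ vs) f-periodic = Δ-periodic v (Δ*-periodic vs f-periodic)

Δ-annihilates-period : ∀ {d f v} → Periodic d f → + d ∣ℤ v → ∀ y → Δ v f y ≡ 0ℤ
Δ-annihilates-period {d} {f} {v} f-periodic d∣v y =
  trans (cong (_- f (y - v)) (f-periodic y (y - v) (subst (+ d ∣ℤ_) (sym (sub-sub y v)) d∣v)))
        (ℤP.+-inverseʳ (f (y - v)))
  where
  sub-sub : ∀ y v → y - (y - v) ≡ v
  sub-sub = solve-∀

Δ-comm : ∀ v w f y → Δ v (Δ w f) y ≡ Δ w (Δ v f) y
Δ-comm v w f y = begin
  (f y - f (y - w)) - (f (y - v) - f (y - v - w))   ≡⟨ cong (λ t → (f y - f (y - w)) - (f (y - v) - f t)) (swap y v w) ⟩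
  (f y - f (y - w)) - (f (y - v) - f (y - w - v))   ≡⟨ exchange (f y) (f (y - w)) (f (y - v)) (f (y - w - v)) ⟩
  (f y - f (y - v)) - (f (y - w) - f (y - w - v))   ∎
  where
  swap : ∀ y v w → y - v - w ≡ y - w - v
  swap = solve-∀
  exchange : ∀ a b c e → (a - b) - (c - e) ≡ (a - c) - (b - e)
  exchange = solve-∀

Δ*-factor : ∀ {v vs} (v∈vs : v ∈ vs) f y → Δ* vs f y ≡ Δ v (Δ* (vs ─ v∈vs) f) y
Δ*-factor (here refl) f y = refl
Δ*-factor {v} (there {w} {vs} v∈vs) f y = begin
  Δ w (Δ* vs f) y                         ≡⟨ cong₂ _-_ (Δ*-factor v∈vs f y) (Δ*-factor v∈vs f (y - w)) ⟩
  Δ w (Δ v (Δ* (vs ─ v∈vs) f)) y          ≡⟨ Δ-comm w v (Δ* (vs ─ v∈vs) f) y ⟩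
  Δ v (Δ w (Δ* (vs ─ v∈vs) f)) y          ∎

∑-Δ-progression : ∀ {d g} → Periodic d g → ∀ {u L i v} c → d ∣ L ℕ.* u → + d ∣ℤ + u * + i - v →
                  ∑[ j < L ] Δ v g (c + + u * + j) ≡ 0ℤ
∑-Δ-progression {d} {g} g-periodic {u} {L} {i} {v} c d∣Lu d∣ui-v = begin
  ∑[ j < L ] (g (X j) - F j)          ≡⟨ ∑-- L (λ j → g (X j)) F ⟩
  ∑[ j < L ] g (X j) - ∑ L F          ≡⟨ cong (_- ∑ L F) (∑-cong L (λ j → sym (F[j+i]≡g[Xj] j))) ⟩
  ∑[ j < L ] F (j ℕ.+ i) - ∑ L F      ≡⟨ cong (_- ∑ L F) (∑-periodic-shift L F F-periodic i) ⟩
  ∑ L F - ∑ L F                       ≡⟨ ℤP.+-inverseʳ (∑ L F) ⟩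
  0ℤ                                  ∎
  where
  X : ℕ → ℤ
  X j = c + + u * + j
  F : ℕ → ℤ
  F j = g (X j - v)
  X-shift : ∀ j k → X (j ℕ.+ k) ≡ X j + + u * + k
  X-shift j k = trans (cong (λ t → c + + u * t) (ℤP.pos-+ j k)) (distrib c (+ u) (+ j) (+ k))
    where
    distrib : ∀ c u j k → c + u * (j + k) ≡ c + u * j + u * k
    distrib = solve-∀
  F-periodic : ∀ j → F (j ℕ.+ L) ≡ F j
  F-periodic j = g-periodic _ _ (subst (+ d ∣ℤ_) (sym step) (subst (+ d ∣ℤ_) (ℤP.pos-* L u) (ℤ∣.∣ᵤ⇒∣ d∣Lu)))
    where
    cancel : ∀ x w v → x + w - v - (x - v) ≡ w
    cancel = solve-∀
    step : X (j ℕ.+ L) - v - (X j - v) ≡ + L * + u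
    step = trans (cong (λ t → t - v - (X j - v)) (X-shift j L))
                 (trans (cancel (X j) (+ u * + L) v) (ℤP.*-comm (+ u) (+ L)))
  F[j+i]≡g[Xj] : ∀ j → F (j ℕ.+ i) ≡ g (X j)
  F[j+i]≡g[Xj] j = g-periodic _ _ (subst (+ d ∣ℤ_) (sym step) d∣ui-v)
    where
    cancel : ∀ x w v → x + w - v - x ≡ w - v
    cancel = solve-∀
    step : X (j ℕ.+ i) - v - X j ≡ + u * + i - v
    step = trans (cong (λ t → t - v - X j) (X-shift j i)) (cancel (X j) (+ u * + i) v)

-- The order d / (d, u) of u modulo d

∃-prime∣ : ∀ {n} → 1 < n → ∃[ p ] (Prime p × p ∣ n)
∃-prime∣ {n} 1<n with factorise n {{ℕ.>-nonZero (ℕP.<-trans ℕP.0<1+n 1<n)}}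
... | record { factors = [] ; isFactorisation = n≡1 } = contradiction n≡1 (ℕP.>⇒≢ 1<n)
... | record { factors = p ∷ ps ; isFactorisation = n≡p*ps ; factorsPrime = p-prime ∷ _ } =
  p , p-prime , ℕ∣.divides (product ps) (trans n≡p*ps (ℕP.*-comm p (product ps)))

module _ (d : ℕ) .{{_ : NonZero d}} (x : ℕ) where

  private instance
    gcd-nonZero : NonZero (gcd d x)
    gcd-nonZero = ℕ.≢-nonZero (gcd[m,n]≢0 d x (inj₁ (ℕ.≢-nonZero⁻¹ d)))

  dOverGcd*gcd : dOverGcd d x ℕ.* gcd d x ≡ d
  dOverGcd*gcd = ℕDM.m/n*n≡m (gcd[m,n]∣m d x)

  dOverGcd∣ : ∀ ℓ → d ∣ ℓ ℕ.* x → dOverGcd d x ∣ ℓ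
  dOverGcd∣ ℓ d∣ℓx = coprime-divisor (coprime-/gcd d x) (ℕ∣.*-cancelʳ-∣ (gcd d x) (subst₂ _∣_ (sym dOverGcd*gcd) ℓx≡ d∣ℓx))
    where
    ℓx≡ : ℓ ℕ.* x ≡ (x ℕ./ gcd d x) ℕ.* ℓ ℕ.* gcd d x
    ℓx≡ = begin
      ℓ ℕ.* x                                 ≡⟨ cong (ℓ ℕ.*_) (sym (ℕDM.m/n*n≡m (gcd[m,n]∣n d x))) ⟩
      ℓ ℕ.* (x ℕ./ gcd d x ℕ.* gcd d x)       ≡⟨ reorder ℓ (x ℕ./ gcd d x) (gcd d x) ⟩
      x ℕ./ gcd d x ℕ.* ℓ ℕ.* gcd d x         ∎
      where
      reorder : ∀ ℓ a g → ℓ ℕ.* (a ℕ.* g) ≡ a ℕ.* ℓ ℕ.* g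
      reorder = ℕRing.solve-∀

  dOverGcd∣d : dOverGcd d x ∣ d
  dOverGcd∣d = ℕ∣.divides (gcd d x) (trans (sym dOverGcd*gcd) (ℕP.*-comm _ (gcd d x)))

  1<dOverGcd : ¬ d ∣ x → 1 < dOverGcd d x
  1<dOverGcd d∤x = from-quotient (dOverGcd d x) dOverGcd*gcd
    where
    from-quotient : ∀ o → o ℕ.* gcd d x ≡ d → 1 < o
    from-quotient zero          0≡d  = contradiction (sym 0≡d) (ℕ.≢-nonZero⁻¹ d)
    from-quotient (suc zero)    g+0≡d = contradiction (subst (_∣ x) (trans (sym (ℕP.+-identityʳ _)) g+0≡d) (gcd[m,n]∣n d x)) d∤x
    from-quotient (suc (suc _)) _    = ℕ.s≤s (ℕ.s≤s ℕ.z≤n)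

pos-[a+b*c≡e*f] : ∀ {a b c e f} → a ℕ.+ b ℕ.* c ≡ e ℕ.* f → + a + + b * + c ≡ + e * + f
pos-[a+b*c≡e*f] {a} {b} {c} {e} {f} eq = begin
  + a + + b * + c       ≡⟨ cong (_+_ (+ a)) (sym (ℤP.pos-* b c)) ⟩
  + a + + (b ℕ.* c)     ≡⟨ sym (ℤP.pos-+ a (b ℕ.* c)) ⟩
  + (a ℕ.+ b ℕ.* c)     ≡⟨ cong +_ eq ⟩
  + (e ℕ.* f)           ≡⟨ ℤP.pos-* e f ⟩
  + e * + f             ∎

-- In the second form of Bézout's identity the multiple of u is negative; since d ∣ u d,
-- multiplying it by d − 1 ≡ −1 (mod d) makes it natural.
multiple≡gcd-mod : ∀ d .{{_ : NonZero d}} u → ∃[ i ] (+ d ∣ℤ + u * + i - + gcd d u)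
multiple≡gcd-mod d@(suc d′) u with Bézout.identity (gcd-GCD d u)
... | Bézout.-+ x y g+xd≡yu = y , divides (+ x) (begin
  + u * + y - + g
    ≡⟨ cong (_- + g) (trans (ℤP.*-comm (+ u) (+ y)) (sym (pos-[a+b*c≡e*f] {gcd d u} {x} {d} {y} {u} g+xd≡yu))) ⟩
  (+ g + + x * + d) - + g
    ≡⟨ add-sub (+ g) (+ x * + d) ⟩
  + x * + d ∎)
  where
  g = gcd d u
  add-sub : ∀ a b → (a + b) - a ≡ b
  add-sub = solve-∀
... | Bézout.+- x y g+yu≡xd = y ℕ.* d′ , divides (+ u * + y - + x) (begin
  + u * + (y ℕ.* d′) - + g
    ≡⟨ cong (λ t → + u * t - + g) (ℤP.pos-* y d′) ⟩
  + u * (+ y * + d′) - + g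
    ≡⟨ expand (+ u) (+ y) (+ d′) (+ g) ⟩
  + u * + y * (1ℤ + + d′) - (+ g + + y * + u)
    ≡⟨ cong (λ t → + u * + y * + d - t) (pos-[a+b*c≡e*f] {gcd d u} {y} {u} {x} {d} g+yu≡xd) ⟩
  + u * + y * + d - + x * + d
    ≡⟨ factor (+ u * + y) (+ x) (+ d) ⟩
  (+ u * + y - + x) * + d ∎)
  where
  g = gcd d u
  expand : ∀ u y d′ g → u * (y * d′) - g ≡ u * y * (1ℤ + d′) - (g + y * u)
  expand = solve-∀
  factor : ∀ a x d → a * d - x * d ≡ (a - x) * d
  factor = solve-∀

module Kernel (d : ℕ) .{{_ : NonZero d}} where

  δ : ℤ → ℤ
  δ y = when (d ∣? ℤ.∣ y ∣) 1ℤ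

  δ-periodic : Periodic d δ
  δ-periodic x y = when∣-cong x y 1ℤ

  primeDivisor? : ∀ p → Dec (Prime p × p ∣ d)
  primeDivisor? p = prime? p ×-dec p ∣? d

  shiftsBelow : ℕ → List ℤ
  shiftsBelow zero = []
  shiftsBelow (suc t) with primeDivisor? t
  ... | yes (_ , ℕ∣.divides q _) = + q ∷ shiftsBelow t
  ... | no _                     = shiftsBelow t

  primeProductBelow : ℕ → ℕ
  primeProductBelow zero = 1
  primeProductBelow (suc t) with primeDivisor? t
  ... | yes _ = t ℕ.* primeProductBelow t
  ... | no _  = primeProductBelow t

  π : ℕ → ℤ → ℤ
  π t = Δ* (shiftsBelow t) δ

  kernel : ℤ → ℤ
  kernel = π (suc d)

  primeProductBelow-coprime : ∀ {p} t → Prime p → t ≤ p → ¬ p ∣ primeProductBelow t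
  primeProductBelow-coprime zero p-prime _ p∣1 with ℕ∣.∣1⇒≡1 p∣1
  primeProductBelow-coprime zero () _ _ | refl
  primeProductBelow-coprime {p} (suc t) p-prime t<p p∣Q with primeDivisor? t
  ... | yes (t-prime , _) with euclidsLemma t (primeProductBelow t) p-prime p∣Q
  ...   | inj₁ p∣t = ℕP.<⇒≱ t<p (ℕ∣.∣⇒≤ {{prime⇒nonZero t-prime}} p∣t)
  ...   | inj₂ p∣Q′ = primeProductBelow-coprime t p-prime (ℕP.<⇒≤ t<p) p∣Q′
  primeProductBelow-coprime {p} (suc t) p-prime t<p p∣Q | no _ =
    primeProductBelow-coprime t p-prime (ℕP.<⇒≤ t<p) p∣Q

  -- π t vanishes outside {y : d ∣ Q y}, Q the product of the primes used so far; since
  -- t ∤ Q, the shift d/t leaves that set, which is why every π t takes the value 1 at 0.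
  π-support : ∀ t y → ¬ (+ d ∣ℤ + primeProductBelow t * y) → π t y ≡ 0ℤ
  π-support zero y d∤y = when-no (d ∣? ℤ.∣ y ∣) 1ℤ (λ d∣y → d∤y (subst (+ d ∣ℤ_) (sym (ℤP.*-identityˡ y)) (ℤ∣.∣ᵤ⇒∣ d∣y)))
  π-support (suc t) y d∤Qy with primeDivisor? t
  ... | yes (_ , ℕ∣.divides q d≡qt) = cong₂ _-_ (π-support t y d∤Q′y) (π-support t (y - + q) d∤Q′[y-q])
    where
    Q′ = primeProductBelow t
    tQ′ : + (t ℕ.* Q′) ≡ + t * + Q′
    tQ′ = ℤP.pos-* t Q′
    d∤Q′y : ¬ (+ d ∣ℤ + Q′ * y)
    d∤Q′y d∣Q′y = d∤Qy (subst (+ d ∣ℤ_) (trans (sym (ℤP.*-assoc (+ t) (+ Q′) y)) (cong (_* y) (sym tQ′)))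
                                       (ℤ∣.∣n⇒∣m*n (+ t) d∣Q′y))
    d∣qt : + d ∣ℤ + q * + t
    d∣qt = subst (+ d ∣ℤ_) (trans (cong +_ d≡qt) (ℤP.pos-* q t)) ℤ∣.∣-refl
    recombine : ∀ t Q′ y q → t * (Q′ * (y - q)) + Q′ * (q * t) ≡ (t * Q′) * y
    recombine = solve-∀
    d∤Q′[y-q] : ¬ (+ d ∣ℤ + Q′ * (y - + q))
    d∤Q′[y-q] d∣Q′[y-q] = d∤Qy (subst (+ d ∣ℤ_) (trans (recombine (+ t) (+ Q′) y (+ q)) (cong (_* y) (sym tQ′)))
                                       (ℤ∣.∣m∣n⇒∣m+n (ℤ∣.∣n⇒∣m*n (+ t) d∣Q′[y-q]) (ℤ∣.∣n⇒∣m*n (+ Q′) d∣qt)))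
  ... | no _ = π-support t y d∤Qy

  π-at-0 : ∀ t → π t 0ℤ ≡ 1ℤ
  π-at-0 zero = when-yes (d ∣? 0) 1ℤ (d ℕ∣.∣0)
  π-at-0 (suc t) with primeDivisor? t
  ... | yes (t-prime , ℕ∣.divides q d≡qt) = cong₂ _-_ (π-at-0 t) (π-support t (0ℤ - + q) d∤Q′[0-q])
    where
    Q′ = primeProductBelow t
    negate : ∀ Q′ q → - (Q′ * (0ℤ - q)) ≡ Q′ * q
    negate = solve-∀
    instance
      q-nonZero : NonZero q
      q-nonZero = ℕ∣.quotient≢0 (ℕ∣.divides q d≡qt)
    d∤Q′[0-q] : ¬ (+ d ∣ℤ + Q′ * (0ℤ - + q))
    d∤Q′[0-q] d∣Q′[0-q] = primeProductBelow-coprime t t-prime ℕP.≤-refl (ℕ∣.*-cancelˡ-∣ q qt∣qQ′)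
      where
      d∣Q′q : d ∣ Q′ ℕ.* q
      d∣Q′q = ℤ∣.∣⇒∣ᵤ (subst (+ d ∣ℤ_) (trans (negate (+ Q′) (+ q)) (sym (ℤP.pos-* Q′ q))) (ℤ∣.∣m⇒∣-m d∣Q′[0-q]))
      qt∣qQ′ : q ℕ.* t ∣ q ℕ.* Q′
      qt∣qQ′ = subst₂ _∣_ d≡qt (ℕP.*-comm Q′ q) d∣Q′q
  ... | no _ = π-at-0 t

  shift∈shiftsBelow : ∀ {p q} t → Prime p → d ≡ q ℕ.* p → p < t → + q ∈ shiftsBelow t
  shift∈shiftsBelow {p} {q} (suc t) p-prime d≡qp p<1+t with primeDivisor? t | ℕP.m<1+n⇒m<n∨m≡n p<1+t
  ... | yes (_ , ℕ∣.divides q′ d≡q′t) | inj₂ refl =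
    here (cong +_ (ℕP.*-cancelʳ-≡ q q′ p {{prime⇒nonZero p-prime}} (trans (sym d≡qp) d≡q′t)))
  ... | yes _   | inj₁ p<t  = there (shift∈shiftsBelow t p-prime d≡qp p<t)
  ... | no ¬pd  | inj₂ refl = contradiction (p-prime , ℕ∣.divides q d≡qp) ¬pd
  ... | no _    | inj₁ p<t  = shift∈shiftsBelow t p-prime d≡qp p<t

  kernel-periodic : Periodic d kernel
  kernel-periodic = Δ*-periodic (shiftsBelow (suc d)) δ-periodic

  kernel-at-0 : kernel 0ℤ ≡ 1ℤ
  kernel-at-0 = π-at-0 (suc d)

  -- If a prime p divides d / (d, u), then d/p is a multiple of (d, u), hence of u
  -- modulo d, so the factor Δ_{d/p} of the kernel telescopes along progressions of step u.
  ∑-kernel-progression : ∀ {u L} → ¬ d ∣ u → d ∣ L ℕ.* u → ∀ c → ∑[ j < L ] kernel (c + + u * + j) ≡ 0ℤ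
  ∑-kernel-progression {u} {L} d∤u d∣Lu c with ∃-prime∣ (1<dOverGcd d u d∤u) | multiple≡gcd-mod d u
  ... | p , p-prime , ℕ∣.divides w o≡wp | i , d∣ui-g =
    trans (∑-cong L (λ j → Δ*-factor q∈shifts δ (c + + u * + j)))
          (∑-Δ-progression (Δ*-periodic (shiftsBelow (suc d) ─ q∈shifts) δ-periodic) {u} {L} {i ℕ.* w} {+ q} c d∣Lu d∣uiw-q)
    where
    g = gcd d u
    q = w ℕ.* g
    d≡qp : d ≡ q ℕ.* p
    d≡qp = begin
      d                   ≡⟨ sym (dOverGcd*gcd d u) ⟩
      dOverGcd d u ℕ.* g  ≡⟨ cong (ℕ._* g) o≡wp ⟩
      w ℕ.* p ℕ.* g       ≡⟨ reorder w p g ⟩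
      w ℕ.* g ℕ.* p       ∎
      where
      reorder : ∀ w p g → w ℕ.* p ℕ.* g ≡ w ℕ.* g ℕ.* p
      reorder = ℕRing.solve-∀
    q∈shifts : + q ∈ shiftsBelow (suc d)
    q∈shifts = shift∈shiftsBelow (suc d) p-prime d≡qp (ℕ.s≤s (ℕ∣.∣⇒≤ (ℕ∣.divides q d≡qp)))
    d∣uiw-q : + d ∣ℤ + u * + (i ℕ.* w) - + q
    d∣uiw-q = subst (+ d ∣ℤ_) scale (ℤ∣.∣m⇒∣m*n (+ w) d∣ui-g)
      where
      distrib : ∀ u i g w → (u * i - g) * w ≡ u * (i * w) - w * g
      distrib = solve-∀
      scale : (+ u * + i - + g) * + w ≡ + u * + (i ℕ.* w) - + q
      scale = trans (distrib (+ u) (+ i) (+ g) (+ w))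
                    (cong₂ (λ a b → + u * a - b) (sym (ℤP.pos-* i w)) (sym (ℤP.pos-* w g)))

OrderAbove : ℕ → ℕ → ℕ → Set
OrderAbove d r u = ∀ ℓ → 1 ≤ ℓ → ℓ ≤ r → ¬ d ∣ ℓ ℕ.* u

<dOverGcd⇒OrderAbove : ∀ d .{{_ : NonZero d}} {r} u → r < dOverGcd d u → OrderAbove d r u
<dOverGcd⇒OrderAbove d u r<o ℓ 1≤ℓ ℓ≤r d∣ℓu =
  ℕP.<⇒≱ r<o (ℕP.≤-trans (ℕ∣.∣⇒≤ {{ℕ.>-nonZero 1≤ℓ}} (dOverGcd∣ d u ℓ d∣ℓu)) ℓ≤r)

module Detector (d : ℕ) .{{_ : NonZero d}} where
  open Kernel d using (kernel; kernel-periodic; kernel-at-0; ∑-kernel-progression)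

  -- Ψ R x z = Σ_{S ⊆ R} (−1)^|S| kernel (z + |S| x − Σ S): along a progression x = c + u j
  -- each S ≠ ∅ contributes kernel values along a progression of step |S| u.
  Ψ : List ℕ → ℤ → ℤ → ℤ
  Ψ R x = Δ* (map (λ ρ → + ρ - x) R) kernel

  H : List ℕ → ℤ → ℤ
  H R x = 1ℤ - Ψ R x 0ℤ

  H-residue : ∀ R {ρ x} → ρ ∈ R → + d ∣ℤ x - + ρ → H R x ≡ 1ℤ
  H-residue R {ρ} {x} ρ∈R d∣x-ρ = cong (_-_ 1ℤ) (begin
    Ψ R x 0ℤ
      ≡⟨ Δ*-factor ρ-x∈shifts kernel 0ℤ ⟩
    Δ (+ ρ - x) (Δ* (shifts ─ ρ-x∈shifts) kernel) 0ℤ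
      ≡⟨ Δ-annihilates-period (Δ*-periodic (shifts ─ ρ-x∈shifts) kernel-periodic) d∣ρ-x 0ℤ ⟩
    0ℤ ∎)
    where
    shifts = map (λ ρ → + ρ - x) R
    ρ-x∈shifts : + ρ - x ∈ shifts
    ρ-x∈shifts = ∈-map⁺ (λ ρ → + ρ - x) ρ∈R
    negate : ∀ x ρ → - (x - ρ) ≡ ρ - x
    negate = solve-∀
    d∣ρ-x : + d ∣ℤ + ρ - x
    d∣ρ-x = subst (+ d ∣ℤ_) (negate x (+ ρ)) (ℤ∣.∣m⇒∣-m d∣x-ρ)

  module _ {u L r} (u-order : OrderAbove d r u) (d∣Lu : d ∣ L ℕ.* u) (c : ℤ) where

    X : ℕ → ℤ
    X j = c + + u * + j

    ∑-Ψ-scaled : ∀ R k → 1 ≤ k → k ℕ.+ length R ≤ r → ∀ z → ∑[ j < L ] Ψ R (X j) (z + + k * X j) ≡ 0ℤ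
    ∑-Ψ-scaled [] k 1≤k k≤r z = trans (∑-cong L (λ j → cong kernel (regroup j)))
      (∑-kernel-progression {k ℕ.* u} {L} (u-order k 1≤k (subst (_≤ r) (ℕP.+-identityʳ k) k≤r)) d∣L[ku] (z + + k * c))
      where
      expand : ∀ z k c u j → z + k * (c + u * j) ≡ (z + k * c) + (k * u) * j
      expand = solve-∀
      regroup : ∀ j → z + + k * X j ≡ (z + + k * c) + + (k ℕ.* u) * + j
      regroup j = trans (expand z (+ k) c (+ u) (+ j)) (cong (λ t → (z + + k * c) + t * + j) (sym (ℤP.pos-* k u)))
      d∣L[ku] : d ∣ L ℕ.* (k ℕ.* u)
      d∣L[ku] = subst (d ∣_) (reorder k L u) (ℕ∣.∣n⇒∣m*n k d∣Lu)
        where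
        reorder : ∀ k L u → k ℕ.* (L ℕ.* u) ≡ L ℕ.* (k ℕ.* u)
        reorder = ℕRing.solve-∀
    ∑-Ψ-scaled (ρ ∷ R) k 1≤k k+1+R≤r z = begin
      ∑[ j < L ] (Ψ R (X j) (z + + k * X j) - Ψ R (X j) (z + + k * X j - (+ ρ - X j)))
        ≡⟨ ∑-cong L (λ j → cong (λ t → Ψ R (X j) (z + + k * X j) - Ψ R (X j) t) (step (X j))) ⟩
      ∑[ j < L ] (Ψ R (X j) (z + + k * X j) - Ψ R (X j) ((z - + ρ) + + suc k * X j))
        ≡⟨ ∑-- L _ _ ⟩
      ∑[ j < L ] Ψ R (X j) (z + + k * X j) - ∑[ j < L ] Ψ R (X j) ((z - + ρ) + + suc k * X j)
        ≡⟨ cong₂ _-_ (∑-Ψ-scaled R k 1≤k (ℕP.≤-trans (ℕP.+-monoʳ-≤ k (ℕP.n≤1+n _)) k+1+R≤r) z)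
                     (∑-Ψ-scaled R (suc k) (ℕ.s≤s ℕ.z≤n) (subst (_≤ r) (ℕP.+-suc k _) k+1+R≤r) (z - + ρ)) ⟩
      0ℤ ∎
      where
      expand : ∀ z k x ρ → z + k * x - (ρ - x) ≡ (z - ρ) + (1ℤ + k) * x
      expand = solve-∀
      step : ∀ x → z + + k * x - (+ ρ - x) ≡ (z - + ρ) + + suc k * x
      step x = expand z (+ k) x (+ ρ)

    ∑-Ψ : ∀ R → length R ≤ r → ∀ z → ∑[ j < L ] Ψ R (X j) z ≡ + L * kernel z
    ∑-Ψ []      _       z = ∑-const L (kernel z)
    ∑-Ψ (ρ ∷ R) 1+R≤r z = begin
      ∑[ j < L ] (Ψ R (X j) z - Ψ R (X j) (z - (+ ρ - X j)))
        ≡⟨ ∑-cong L (λ j → cong (λ t → Ψ R (X j) z - Ψ R (X j) t) (step (X j))) ⟩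
      ∑[ j < L ] (Ψ R (X j) z - Ψ R (X j) ((z - + ρ) + + 1 * X j))
        ≡⟨ ∑-- L _ _ ⟩
      ∑[ j < L ] Ψ R (X j) z - ∑[ j < L ] Ψ R (X j) ((z - + ρ) + + 1 * X j)
        ≡⟨ cong₂ _-_ (∑-Ψ R (ℕP.≤-trans (ℕP.n≤1+n _) 1+R≤r) z) (∑-Ψ-scaled R 1 ℕP.≤-refl 1+R≤r (z - + ρ)) ⟩
      + L * kernel z - 0ℤ
        ≡⟨ ℤP.+-identityʳ _ ⟩
      + L * kernel z ∎
      where
      expand : ∀ z x ρ → z - (ρ - x) ≡ (z - ρ) + 1ℤ * x
      expand = solve-∀
      step : ∀ x → z - (+ ρ - x) ≡ (z - + ρ) + + 1 * x
      step x = expand z x (+ ρ)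

  ∑-H-progression : ∀ R {u L} → OrderAbove d (length R) u → d ∣ L ℕ.* u → ∀ c →
                    ∑[ j < L ] H R (c + + u * + j) ≡ 0ℤ
  ∑-H-progression R {u} {L} u-order d∣Lu c = begin
    ∑[ j < L ] (1ℤ - Ψ R (c + + u * + j) 0ℤ)
      ≡⟨ ∑-- L (λ _ → 1ℤ) _ ⟩
    ∑[ j < L ] 1ℤ - ∑[ j < L ] Ψ R (c + + u * + j) 0ℤ
      ≡⟨ cong₂ _-_ (∑-const L 1ℤ) (∑-Ψ {u} {L} u-order d∣Lu c R ℕP.≤-refl 0ℤ) ⟩
    + L * 1ℤ - + L * kernel 0ℤ
      ≡⟨ cong (λ t → + L * 1ℤ - + L * t) kernel-at-0 ⟩
    + L * 1ℤ - + L * 1ℤ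
      ≡⟨ ℤP.+-inverseʳ (+ L * 1ℤ) ⟩
    0ℤ ∎

-- Periods modulo m

module _ {m : ℤ} {f : ℤ → ℤ} where

  exact-period : ∀ {p} → (∀ x → f (x + + p) ≡ f x) → IsPeriodMod m f p
  exact-period f-periodic x =
    subst (m ℤD.∣_) (sym (trans (cong (_- f x) (f-periodic x)) (ℤP.+-inverseʳ (f x)))) (ℤ.∣ m ∣ ℕ∣.∣0)

  period⇒∣ℤ : ∀ {p} → IsPeriodMod m f p → ∀ x → m ∣ℤ f (x + + p) - f x
  period⇒∣ℤ {p} p-period x = ℤ∣.∣ᵤ⇒∣ {m} {f (x + + p) - f x} (p-period x)

  period-* : ∀ {p} → IsPeriodMod m f p → ∀ q → IsPeriodMod m f (q ℕ.* p)
  period-* p-period zero    = exact-period (λ x → cong f (ℤP.+-identityʳ x))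
  period-* {p} p-period (suc q) x = ℤ∣.∣⇒∣ᵤ (subst (m ∣ℤ_) telescope
    (ℤ∣.∣m∣n⇒∣m+n (period⇒∣ℤ p-period (x + + (q ℕ.* p))) (period⇒∣ℤ (period-* p-period q) x)))
    where
    y = x + + (q ℕ.* p)
    x+[p+qp] : x + + (p ℕ.+ q ℕ.* p) ≡ y + + p
    x+[p+qp] = trans (cong (_+_ x) (ℤP.pos-+ p (q ℕ.* p))) (reorder x (+ p) (+ (q ℕ.* p)))
      where
      reorder : ∀ x p qp → x + (p + qp) ≡ x + qp + p
      reorder = solve-∀
    cancel : ∀ a b c → (a - b) + (b - c) ≡ a - c
    cancel = solve-∀
    telescope : (f (y + + p) - f y) + (f y - f x) ≡ f (x + + (p ℕ.+ q ℕ.* p)) - f x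
    telescope = trans (cancel (f (y + + p)) (f y) (f x)) (cong (λ t → f t - f x) (sym x+[p+qp]))

  period-cancel : ∀ {a b} → IsPeriodMod m f (a ℕ.+ b) → IsPeriodMod m f b → IsPeriodMod m f a
  period-cancel {a} {b} a+b-period b-period x = ℤ∣.∣⇒∣ᵤ (subst (m ∣ℤ_) telescope
    (ℤ∣.∣m∣n⇒∣m-n (period⇒∣ℤ a+b-period x) (period⇒∣ℤ b-period (x + + a))))
    where
    cancel : ∀ a b c → (a - c) - (a - b) ≡ b - c
    cancel = solve-∀
    x+[a+b] : x + + (a ℕ.+ b) ≡ x + + a + + b
    x+[a+b] = trans (cong (_+_ x) (ℤP.pos-+ a b)) (sym (ℤP.+-assoc x (+ a) (+ b)))
    telescope : (f (x + + (a ℕ.+ b)) - f x) - (f (x + + a + + b) - f (x + + a)) ≡ f (x + + a) - f x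
    telescope = trans (cong (λ t → (f t - f x) - (f (x + + a + + b) - f (x + + a))) x+[a+b])
                      (cancel (f (x + + a + + b)) (f (x + + a)) (f x))

  leastPeriod∣period : ∀ {n₀ N} → IsLeastPositivePeriodMod m f n₀ → IsPeriodMod m f N → n₀ ∣ N
  leastPeriod∣period {n₀} {N} (0<n₀ , n₀-period , n₀-least) N-period =
    ℕ∣.m%n≡0⇒n∣m N n₀ (remainder-period-0 (N ℕ.% n₀) refl)
    where
    instance
      n₀-nonZero : NonZero n₀
      n₀-nonZero = ℕ.>-nonZero 0<n₀
    remainder-period : IsPeriodMod m f (N ℕ.% n₀)
    remainder-period = period-cancel (subst (IsPeriodMod m f) (ℕDM.m≡m%n+[m/n]*n N n₀) N-period)
                                     (period-* n₀-period (N ℕ./ n₀))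
    remainder-period-0 : ∀ r → N ℕ.% n₀ ≡ r → r ≡ 0
    remainder-period-0 zero    _     = refl
    remainder-period-0 (suc r) N%n₀≡ = contradiction (n₀-least (suc r) ℕP.0<1+n (subst (IsPeriodMod m f) N%n₀≡ remainder-period))
                                                     (ℕP.<⇒≱ (subst (_< n₀) N%n₀≡ (ℕDM.m%n<n N n₀)))

Σℤ-cong : ∀ k {f g : Fin k → ℤ} → (∀ s → f s ≡ g s) → Σℤ k f ≡ Σℤ k g
Σℤ-cong zero    f≗g = refl
Σℤ-cong (suc k) f≗g = cong₂ _+_ (f≗g zero) (Σℤ-cong k (λ s → f≗g (suc s)))

Σℤ-*ʳ : ∀ k (f : Fin k → ℤ) c → Σℤ k f * c ≡ Σℤ k (λ s → f s * c)
Σℤ-*ʳ zero    f c = refl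
Σℤ-*ʳ (suc k) f c = trans (ℤP.*-distribʳ-+ c (f zero) (Σℤ k (λ s → f (suc s))))
                          (cong (λ t → f zero * c + t) (Σℤ-*ʳ k (λ s → f (suc s)) c))

∑-Σℤ : ∀ M k (F : Fin k → ℕ → ℤ) → ∑[ x < M ] Σℤ k (λ s → F s x) ≡ Σℤ k (λ s → ∑ M (F s))
∑-Σℤ M zero    F = ∑-zero M (λ _ → refl)
∑-Σℤ M (suc k) F = trans (∑-+ M (F zero) (λ x → Σℤ k (λ s → F (suc s) x)))
                         (cong (λ t → ∑ M (F zero) + t) (∑-Σℤ M k (λ s → F (suc s))))

-- The two evaluations of T

∣lcmAll : ∀ k (n : Fin k → ℕ) s → n s ∣ lcmAll k n
∣lcmAll (suc k) n zero    = m∣lcm[m,n] (n zero) _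
∣lcmAll (suc k) n (suc s) = ℕ∣.∣-trans (∣lcmAll k (λ s → n (suc s)) s) (n∣lcm[m,n] (n zero) _)

w-lcm-periodic : ∀ k a n λs x → w k a n λs (x + + lcmAll k n) ≡ w k a n λs x
w-lcm-periodic k a n λs x = Σℤ-cong k (λ s → when∣-cong-sub (x + + N) x (a s) (λs s) (n∣shift s))
  where
  N = lcmAll k n
  cancel : ∀ x N → x + N - x ≡ N
  cancel = solve-∀
  n∣shift : ∀ s → + n s ∣ℤ x + + N - x
  n∣shift s = subst (+ n s ∣ℤ_) (sym (cancel x (+ N))) (ℤ∣.∣ᵤ⇒∣ {+ n s} {+ N} (∣lcmAll k n s))

module Divisibility
  (k : ℕ) (a : Fin k → ℤ) (n : Fin k → ℕ) (npos : ∀ s → NonZero (n s)) (λs : Fin k → ℤ)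
  (m : ℤ) (n₀ : ℕ) (n₀-least : IsLeastPositivePeriodMod m (w k a n λs) n₀)
  (d : ℕ) .{{_ : NonZero d}} (d∣N : d ∣ lcmAll k n)
  (n₀-order : OrderAbove d (residueCount k a n d) n₀)
  (n-order : ∀ s → ¬ d ∣ n s → OrderAbove d (residueCount k a n d) (n s))
  where

  open Detector d using (H; H-residue; ∑-H-progression)

  W : ℤ → ℤ
  W = w k a n λs

  N : ℕ
  N = lcmAll k n

  R : List ℕ
  R = deduplicate ℕ._≟_ (map (λ s → a s ℤ.%ℕ d) (Iset k n d))

  T : ℤ
  T = ∑[ x < N ] (W (+ x) * H R (+ x))

  residue∈R : ∀ s → d ∣ n s → a s ℤ.%ℕ d ∈ R
  residue∈R s d∣n = ∈-deduplicate⁺ ℕ._≟_ (∈-map⁺ (λ s → a s ℤ.%ℕ d) (∈-filter⁺ (λ s → d ∣? n s) (∈-allFin s) d∣n))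

  module _ (s : Fin k) where
    private instance
      n-nonZero : NonZero (n s)
      n-nonZero = npos s

    M : ℕ
    M = N ℕ./ n s

    ∑-λH-on-class : ∀ y → n s ∣ ℤ.∣ + y - a s ∣ →
                    ∑[ j < M ] (λs s * H R (+ (j ℕ.* n s ℕ.+ y))) ≡ when (d ∣? n s) (λs s * + M)
    ∑-λH-on-class y n∣y-a with d ∣? n s
    ... | yes d∣n = trans (∑-*ˡ M (λs s) _) (cong (λs s *_) (begin
      ∑[ j < M ] H R (+ (j ℕ.* n s ℕ.+ y))
        ≡⟨ ∑-cong M (λ j → H-residue R {a s ℤ.%ℕ d} {+ (j ℕ.* n s ℕ.+ y)} (residue∈R s d∣n) (d∣[jn+y]-ρ j)) ⟩
      ∑[ j < M ] 1ℤ
        ≡⟨ ∑-const M 1ℤ ⟩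
      + M * 1ℤ
        ≡⟨ ℤP.*-identityʳ (+ M) ⟩
      + M ∎))
      where
      n∣[jn+y]-a : ∀ j → + n s ∣ℤ + (j ℕ.* n s ℕ.+ y) - a s
      n∣[jn+y]-a j = subst (+ n s ∣ℤ_) (sym (trans (cong (_- a s) (pos-[j*n+y] (n s) j y)) (reorder (+ y) (+ n s) (+ j) (a s))))
                            (ℤ∣.∣m∣n⇒∣m+n (ℤ∣.∣ᵤ⇒∣ {+ n s} {+ y - a s} n∣y-a) (ℤ∣.∣m⇒∣m*n (+ j) ℤ∣.∣-refl))
        where
        reorder : ∀ y n j a → y + n * j - a ≡ (y - a) + n * j
        reorder = solve-∀
      d∣[jn+y]-ρ : ∀ j → + d ∣ℤ + (j ℕ.* n s ℕ.+ y) - + (a s ℤ.%ℕ d)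
      d∣[jn+y]-ρ j = subst (+ d ∣ℤ_) (chain (+ (j ℕ.* n s ℕ.+ y)) (a s) (+ (a s ℤ.%ℕ d)))
                            (ℤ∣.∣m∣n⇒∣m+n (ℤ∣.∣-trans (ℤ∣.∣ᵤ⇒∣ {+ d} {+ n s} d∣n) (n∣[jn+y]-a j)) (n∣a-a%n (a s) d))
        where
        chain : ∀ x a ρ → (x - a) + (a - ρ) ≡ x - ρ
        chain = solve-∀
    ... | no d∤n = trans (∑-*ˡ M (λs s) _) (trans (cong (λs s *_) (begin
      ∑[ j < M ] H R (+ (j ℕ.* n s ℕ.+ y))    ≡⟨ ∑-cong M (λ j → cong (H R) (pos-[j*n+y] (n s) j y)) ⟩
      ∑[ j < M ] H R (+ y + + n s * + j)     ≡⟨ ∑-H-progression R {n s} {M} (n-order s d∤n) d∣Mn (+ y) ⟩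
      0ℤ                                     ∎)) (ℤP.*-zeroʳ (λs s)))
      where
      d∣Mn : d ∣ M ℕ.* n s
      d∣Mn = subst (d ∣_) (sym (ℕDM.m/n*n≡m (∣lcmAll k n s))) d∣N

    class-contribution : ∑[ x < N ] when (n s ∣? ℤ.∣ + x - a s ∣) (λs s * H R (+ x)) ≡ when (d ∣? n s) (λs s * + M)
    class-contribution = begin
      ∑[ x < N ] when (n s ∣? ℤ.∣ + x - a s ∣) (λs s * H R (+ x))
        ≡⟨ cong (λ t → ∑[ x < t ] when (n s ∣? ℤ.∣ + x - a s ∣) (λs s * H R (+ x))) (sym (ℕDM.m/n*n≡m (∣lcmAll k n s))) ⟩
      ∑[ x < M ℕ.* n s ] when (n s ∣? ℤ.∣ + x - a s ∣) (λs s * H R (+ x))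
        ≡⟨ ∑-residue-class M (n s) (a s) (λ x → λs s * H R (+ x)) _ ∑-λH-on-class ⟩
      when (d ∣? n s) (λs s * + M) ∎

  T≡lcmWeightedSum : T ≡ lcmWeightedSum k n npos λs d
  T≡lcmWeightedSum = begin
    ∑[ x < N ] (W (+ x) * H R (+ x))
      ≡⟨ ∑-cong N (λ x → trans (Σℤ-*ʳ k _ (H R (+ x))) (Σℤ-cong k (λ s → when-*ʳ (n s ∣? _) (λs s) (H R (+ x))))) ⟩
    ∑[ x < N ] Σℤ k (λ s → when (n s ∣? ℤ.∣ + x - a s ∣) (λs s * H R (+ x)))
      ≡⟨ ∑-Σℤ N k (λ s x → when (n s ∣? ℤ.∣ + x - a s ∣) (λs s * H R (+ x))) ⟩
    Σℤ k (λ s → ∑[ x < N ] when (n s ∣? ℤ.∣ + x - a s ∣) (λs s * H R (+ x)))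
      ≡⟨ Σℤ-cong k class-contribution ⟩
    lcmWeightedSum k n npos λs d ∎

  m∣T : m ∣ℤ T
  m∣T = subst (m ∣ℤ_) (sym T-by-residue) (∑-∣ n₀ _ m∣block)
    where
    n₀∣N : n₀ ∣ N
    n₀∣N = leastPeriod∣period {m} {W} n₀-least (exact-period {m} (w-lcm-periodic k a n λs))
    M₀ : ℕ
    M₀ = ℕ∣.quotient n₀∣N
    f : ℕ → ℤ
    f x = W (+ x) * H R (+ x)
    T-by-residue : T ≡ ∑[ y < n₀ ] ∑[ j < M₀ ] f (j ℕ.* n₀ ℕ.+ y)
    T-by-residue = trans (cong (λ t → ∑ t f) (ℕ∣._∣_.equality n₀∣N)) (∑-residues M₀ n₀ f)
    W-shift : ∀ y j → m ∣ℤ W (+ (j ℕ.* n₀ ℕ.+ y)) - W (+ y)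
    W-shift y j = subst (λ t → m ∣ℤ W t - W (+ y)) (trans (sym (ℤP.pos-+ y (j ℕ.* n₀))) (cong +_ (ℕP.+-comm y (j ℕ.* n₀))))
                        (period⇒∣ℤ {m} {W} (period-* {m} {W} (proj₁ (proj₂ n₀-least)) j) (+ y))
    ∑-H : ∀ y → ∑[ j < M₀ ] H R (+ (j ℕ.* n₀ ℕ.+ y)) ≡ 0ℤ
    ∑-H y = trans (∑-cong M₀ (λ j → cong (H R) (pos-[j*n+y] n₀ j y)))
                  (∑-H-progression R {n₀} {M₀} n₀-order (subst (d ∣_) (ℕ∣._∣_.equality n₀∣N) d∣N) (+ y))
    m∣block : ∀ y → m ∣ℤ ∑[ j < M₀ ] f (j ℕ.* n₀ ℕ.+ y)
    m∣block y = ∣∑*-zero-sum M₀ (λ j → W (+ (j ℕ.* n₀ ℕ.+ y))) (λ j → H R (+ (j ℕ.* n₀ ℕ.+ y))) (W (+ y))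
                             (W-shift y) (∑-H y)

  m∣lcmWeightedSum : m ℤD.∣ lcmWeightedSum k n npos λs d
  m∣lcmWeightedSum = ℤ∣.∣⇒∣ᵤ (subst (m ∣ℤ_) T≡lcmWeightedSum m∣T)

residueCount≤|I| : ∀ k a n d .{{_ : NonZero d}} → residueCount k a n d ≤ length (Iset k n d)
residueCount≤|I| k a n d = ℕP.≤-trans (ListP.length-deduplicate ℕ._≟_ (map residue (Iset k n d)))
                                      (ℕP.≤-reflexive (ListP.length-map residue (Iset k n d)))
  where
  residue : Fin k → ℕ
  residue s = a s ℤ.%ℕ d

smallestPrime≤dOverGcd : ∀ d .{{_ : NonZero d}} x → ¬ d ∣ x → ∀ p → IsSmallestPrimeDivisor p d → p ≤ dOverGcd d x
smallestPrime≤dOverGcd d x d∤x p (_ , _ , p-least) with 1<dOverGcd d x d∤x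
... | 1<o with ∃-prime∣ 1<o
... | q , q-prime , q∣o = ℕP.≤-trans (p-least q q-prime (ℕ∣.∣-trans q∣o (dOverGcd∣d d x)))
                                     (ℕ∣.∣⇒≤ {{ℕ.>-nonZero (ℕP.<-trans ℕP.0<1+n 1<o)}} q∣o)

theorem1p3 : (k : ℕ) → 2 ≤ k →
    (a : Fin k → ℤ) (n : Fin k → ℕ) (npos : ∀ s → NonZero (n s)) (λs : Fin k → ℤ) →
    (m : ℤ) (n₀ : ℕ) → IsLeastPositivePeriodMod m (w k a n λs) n₀ →
    (d : ℕ) {{dpos : NonZero d}} → ¬ (d ∣ n₀) → (∃[ s ] (d ∣ n s)) →
    (m ℤD.∣ lcmWeightedSum k n npos λs d)
    ⊎ ( (residueCount k a n d ≤ length (Iset k n d))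
      × (∃[ s ] (¬ (d ∣ nExt k n₀ n s) × (dOverGcd d (nExt k n₀ n s) ≤ residueCount k a n d)))
      × (∀ (s : Fin (suc k)) → ¬ (d ∣ nExt k n₀ n s) →
           ∀ p → IsSmallestPrimeDivisor p d → p ≤ dOverGcd d (nExt k n₀ n s)) )
theorem1p3 k _ a n npos λs m n₀ n₀-least d d∤n₀ (s , d∣ns)
  with any? (λ s → ¬? (d ∣? nExt k n₀ n s) ×-dec (dOverGcd d (nExt k n₀ n s) ℕ.≤? residueCount k a n d))
... | yes small-order = inj₂ (residueCount≤|I| k a n d , small-order , λ s d∤ns → smallestPrime≤dOverGcd d _ d∤ns)
... | no ¬small-order = inj₁ (Divisibility.m∣lcmWeightedSum k a n npos λs m n₀ n₀-least d
                                 (ℕ∣.∣-trans d∣ns (∣lcmAll k n s)) (large-order zero d∤n₀) (λ s → large-order (suc s)))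
  where
  large-order : ∀ s → ¬ d ∣ nExt k n₀ n s → OrderAbove d (residueCount k a n d) (nExt k n₀ n s)
  large-order s d∤ns = <dOverGcd⇒OrderAbove d _ (ℕP.≰⇒> (λ o≤r → ¬small-order (s , d∤ns , o≤r)))
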